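{- Let $\beta,\gamma$ be real numbers with $\gamma\neq 0$. Let $G$ be a digraph with no loops and no multiple arcs, with vertex set $V(G)=\{v_1,\ldots,v_n\}$ and arc set $E(G)$ of size $m$. Let $A$ be the adjacency matrix of $G$ and $D$ its in-degree diagonal matrix, and define the polynomials \[ g_1(G;x)=\det(xI_n-\beta D-\gamma A),\qquad g_2(G;x)={\rm per}(xI_n-\beta D-\gamma A). \] Then, as polynomials in $x$, \[ (m-n)g_1(G;x)+x\,g_1'(G;x)=\sum_{e\in E(G)}g_1(G-e;x), \] \[ (m-n)g_2(G;x)+x\,g_2'(G;x)=\sum_{e\in E(G)}g_2(G-e;x), \] where $g_i'$ denotes the derivative with respect to $x$.
   Context: For a digraph $G$ on vertices $v_1,\ldots,v_n$, the adjacency matrix is $A=(a_{ij})_{n\times n}$ with $a_{ij}=1$ if $(v_i,v_j)$ is an arc and $a_{ij}=0$ otherwise; the in-degree diagonal matrix is $D=\mathrm{diag}(d^+(v_1),\ldots,d^+(v_n))$, where $d^+(v_i)$ is the number of arcs with head $v_i$. For an arc $e$, $G-e$ is the digraph on the same vertex set $\{v_1,\ldots,v_n\}$ with arc set $E(G)\setminus\{e\}$, and $g_i(G-e;x)$ is defined using the adjacency and in-degree matrices of $G-e$. ${\rm per}$ denotes the permanent, ${\rm per}(Y)=\sum_{\alpha\in S_n}\prod_{k=1}^n y_{k\alpha(k)}$. -}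

module Defs where

open import Level using (_⊔_)
open import Data.Nat as ℕ using (ℕ; zero; suc)
open import Data.Fin as Fin using (Fin; zero; suc; punchIn)
open import Data.Product using (_×_; _,_; proj₁; proj₂)
open import Data.Product.Properties using (≡-dec)
open import Data.Fin.Properties as FinP using ()
open import Data.List as List using (List; []; _∷_; length; filter; removeAt)
open import Data.List.Relation.Unary.Any using (any?)
open import Data.List.Relation.Unary.All using (All)
open import Data.List.Relation.Unary.Unique.Propositional using (Unique)
open import Relation.Nullary using (¬_; yes; no)
open import Relation.Nullary.Decidable using (⌊_⌋)
open import Relation.Binary.PropositionalEquality using (_≡_)
open import Algebra.Bundles using (CommutativeRing)
open import Data.Bool using (Bool)

sumFin : ∀ {a} {A : Set a} → (A → A → A) → A → ∀ {n} → (Fin n → A) → A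
sumFin _+_ z {zero}  f = z
sumFin _+_ z {suc n} f = f zero + sumFin _+_ z (λ i → f (suc i))

module DetPer {a} {A : Set a} (_+_ _*_ : A → A → A) (-_ : A → A) (0# 1# : A) where

  minor : ∀ {n} → (Fin (suc n) → Fin (suc n) → A) → Fin (suc n) → Fin n → Fin n → A
  minor M j r c = M (suc r) (punchIn j c)

  signed : ℕ → A → A
  signed zero    x = x
  signed (suc k) x = - (signed k x)

  det : ∀ {n} → (Fin n → Fin n → A) → A
  det {zero}  M = 1#
  det {suc n} M = sumFin _+_ 0# (λ j → signed (Fin.toℕ j) (M zero j * det (minor M j)))

  per : ∀ {n} → (Fin n → Fin n → A) → A
  per {zero}  M = 1#
  per {suc n} M = sumFin _+_ 0# (λ j → M zero j * per (minor M j))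

-- Arcs of a digraph on vertices Fin n: (i , j) is the arc (v_i , v_j), head v_j.
Arc : ℕ → Set
Arc n = Fin n × Fin n

record Digraph (n : ℕ) : Set where
  field
    arcs     : List (Arc n)
    loopless : All (λ e → ¬ (proj₁ e ≡ proj₂ e)) arcs
    simple   : Unique arcs

indeg : ∀ {n} → List (Arc n) → Fin n → ℕ
indeg es v = length (filter (λ e → proj₂ e FinP.≟ v) es)

adjB : ∀ {n} → List (Arc n) → Fin n → Fin n → Bool
adjB es i j = ⌊ any? (λ e → ≡-dec FinP._≟_ FinP._≟_ (i , j) e) es ⌋

module WithRing {c ℓ} (R : CommutativeRing c ℓ) where
  open CommutativeRing R public

  open import Data.Bool using (Bool; true; false; if_then_else_)

  ofℕ : ℕ → Carrier
  ofℕ zero    = 0#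
  ofℕ (suc k) = 1# + ofℕ k

  -- Polynomials over R: coefficient lists, lowest degree first.
  Poly : Set c
  Poly = List Carrier

  coeff : Poly → ℕ → Carrier
  coeff []      k       = 0#
  coeff (a ∷ p) zero    = a
  coeff (a ∷ p) (suc k) = coeff p k

  infix 4 _≋_
  _≋_ : Poly → Poly → Set ℓ
  p ≋ q = ∀ k → coeff p k ≈ coeff q k

  infixl 6 _+P_
  _+P_ : Poly → Poly → Poly
  []      +P q       = q
  (a ∷ p) +P []      = a ∷ p
  (a ∷ p) +P (b ∷ q) = (a + b) ∷ (p +P q)

  scaleP : Carrier → Poly → Poly
  scaleP c p = List.map (c *_) p

  -P_ : Poly → Poly
  -P p = List.map -_ p

  infixl 7 _*P_
  _*P_ : Poly → Poly → Poly
  []      *P q = []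
  (a ∷ p) *P q = scaleP a q +P (0# ∷ (p *P q))

  constP : Carrier → Poly
  constP a = a ∷ []

  0P 1P X : Poly
  0P = []
  1P = constP 1#
  X  = 0# ∷ 1# ∷ []

  derivFrom : ℕ → Poly → Poly
  derivFrom k []      = []
  derivFrom k (b ∷ p) = (ofℕ k * b) ∷ derivFrom (suc k) p

  deriv : Poly → Poly
  deriv []      = []
  deriv (a ∷ p) = derivFrom 1 p

  open DetPer _+P_ _*P_ -P_ 0P 1P public

  charMat : ∀ {n} → Carrier → Carrier → List (Arc n) → Fin n → Fin n → Poly
  charMat {n} β γ es i j =
    (if ⌊ i FinP.≟ j ⌋ then X +P -P constP (β * ofℕ (indeg es i)) else 0P)
      +P -P constP (γ * (if adjB es i j then 1# else 0#))

  g₁ g₂ : ∀ {n} → Carrier → Carrier → List (Arc n) → Poly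
  g₁ β γ es = det (charMat β γ es)
  g₂ β γ es = per (charMat β γ es)

  sumDeleted : ∀ {n} → (List (Arc n) → Poly) → List (Arc n) → Poly
  sumDeleted f es = sumFin _+P_ 0P (λ e → f (removeAt es e))

  mMinusN : ℕ → ℕ → Carrier
  mMinusN m n = ofℕ m - ofℕ n

{-# OPTIONS --safe #-}
-- Write M = xI − (βD + γA) and let g be det or per. Deleting the arc e = (t , h) adds to M the
-- constant matrix Δₑ with β at (h , h) and γ at (t , h), which lives in column h; as g is linear in
-- each column, g(G − e) = g(M) + dg_M(Δₑ), where dg_M(Δ) = Σ_c g(M with column c replaced by that
-- of Δ). Summing over the m arcs gives m g + dg_M(βD + γA) = m g + dg_M(xI) − dg_M(M). Finally
-- dg_M(M) = n g, and the Euler operator x d/dx is a derivation fixing x and killing constants, so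
-- x g′ = dg_M(x d/dx M) = dg_M(xI).
module Submission where

open import Defs
open import Data.Nat using (ℕ)
open import Data.List using (length)
open import Data.Product using (_×_)
open import Relation.Nullary using (¬_)
open import Algebra.Bundles using (CommutativeRing)

open import Level using (_⊔_)
open import Algebra.Bundles using (AbelianGroup; CommutativeMonoid; Monoid; NonAssociativeRing)
open import Data.Bool using (Bool; true; false; if_then_else_; _∨_)
open import Data.Fin using (Fin; zero; suc; toℕ; punchIn; punchOut)
open import Data.Fin.Properties using (_≟_; punchInᵢ≢i; punchIn-punchOut; punchOut-punchIn; punchIn-injective)
open import Data.List using (List; []; _∷_; lookup; removeAt)
open import Data.List.Relation.Unary.All using (All; _∷_)
open import Data.List.Relation.Unary.All.Properties using (All¬⇒¬Any)
open import Data.List.Relation.Unary.AllPairs using (_∷_)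
open import Data.List.Relation.Unary.Any using (any?)
open import Data.List.Relation.Unary.Unique.Propositional using (Unique)
open import Data.Nat as ℕ using (zero; suc)
import Data.Nat.Properties as ℕ
open import Data.Product using (_,_; proj₂)
open import Data.Product.Properties using (≡-dec)
open import Data.Vec.Functional as Vector using (Vector)
open import Function using (id; _∘_)
open import Relation.Nullary using (Dec; does; yes; no; contradiction)
open import Relation.Nullary.Decidable using (⌊_⌋; dec-true; dec-false)
open import Relation.Binary.PropositionalEquality as ≡ using (_≡_; _≢_)
import Algebra.Construct.Pointwise as Pointwise
import Algebra.Definitions.RawMonoid as RawMonoidDefinitions
import Algebra.Properties.AbelianGroup as AbelianGroupProperties
import Algebra.Properties.CommutativeMonoid.Sum as CommutativeMonoidSum
import Algebra.Properties.CommutativeSemigroup as CommutativeSemigroupProperties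
import Algebra.Properties.Group as GroupProperties
import Algebra.Properties.Monoid.Sum as MonoidSum
import Algebra.Properties.Ring as RingProperties
import Algebra.Properties.Semiring.Sum as SemiringSum
import Relation.Binary.Reasoning.Setoid as SetoidReasoning

sumFin≡foldr : ∀ {a} {A : Set a} (_+_ : A → A → A) (z : A) {n} (f : Fin n → A) →
               sumFin _+_ z f ≡ Vector.foldr _+_ z f
sumFin≡foldr _+_ z {zero}  f = ≡.refl
sumFin≡foldr _+_ z {suc n} f = ≡.cong (f zero +_) (sumFin≡foldr _+_ z (f ∘ suc))

sum-pointwise : ∀ {a c ℓ} {A : Set a} (M : Monoid c ℓ) {n} (fs : Fin n → A → Monoid.Carrier M) x →
  RawMonoidDefinitions.sum (Monoid.rawMonoid (Pointwise.monoid A M)) fs x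
    ≡ RawMonoidDefinitions.sum (Monoid.rawMonoid M) (λ e → fs e x)
sum-pointwise M {zero}  fs x = ≡.refl
sum-pointwise M {suc n} fs x = ≡.cong (Monoid._∙_ M (fs zero x)) (sum-pointwise M (fs ∘ suc) x)

module AdditiveMap {a₁ ℓ₁ a₂ ℓ₂} (G : AbelianGroup a₁ ℓ₁) (H : AbelianGroup a₂ ℓ₂)
  (f : AbelianGroup.Carrier G → AbelianGroup.Carrier H)
  (cong : ∀ {x y} → AbelianGroup._≈_ G x y → AbelianGroup._≈_ H (f x) (f y))
  (homo : ∀ x y → AbelianGroup._≈_ H (f (AbelianGroup._∙_ G x y)) (AbelianGroup._∙_ H (f x) (f y)))
  where

  private
    module G = AbelianGroup G
    module ΣG = MonoidSum G.monoid
    module ΣH = MonoidSum (AbelianGroup.monoid H)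
  open AbelianGroup H
  open GroupProperties group using (identityˡ-unique; inverseʳ-unique)
  open SetoidReasoning setoid

  ε-homo : f G.ε ≈ ε
  ε-homo = identityˡ-unique (f G.ε) (f G.ε) (sym (trans (cong (G.sym (G.identityˡ G.ε))) (homo G.ε G.ε)))

  ⁻¹-homo : ∀ x → f (x G.⁻¹) ≈ f x ⁻¹
  ⁻¹-homo x = inverseʳ-unique (f x) (f (x G.⁻¹)) (begin
    f x ∙ f (x G.⁻¹)  ≈⟨ homo x (x G.⁻¹) ⟨
    f (x G.∙ x G.⁻¹)  ≈⟨ cong (G.inverseʳ x) ⟩
    f G.ε             ≈⟨ ε-homo ⟩
    ε                 ∎)

  sum-homo : ∀ {n} (xs : Fin n → G.Carrier) → f (ΣG.sum xs) ≈ ΣH.sum (f ∘ xs)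
  sum-homo {zero}  xs = ε-homo
  sum-homo {suc n} xs = trans (homo _ _) (∙-congˡ (sum-homo (xs ∘ suc)))

All-removeAt : ∀ {a p} {A : Set a} {P : A → Set p} {xs : List A} →
               All P xs → ∀ k → All P (removeAt xs k)
All-removeAt (px ∷ pxs) zero    = pxs
All-removeAt (px ∷ pxs) (suc k) = px ∷ All-removeAt pxs k

Unique-removeAt : ∀ {a} {A : Set a} {xs : List A} → Unique xs → ∀ k → Unique (removeAt xs k)
Unique-removeAt (x∉ ∷ u) zero    = u
Unique-removeAt (x∉ ∷ u) (suc k) = All-removeAt x∉ k ∷ Unique-removeAt u k

module _ {c ℓ} (M : CommutativeMonoid c ℓ) where
  open CommutativeMonoid M
  open MonoidSum monoid using (sum)
  open CommutativeSemigroupProperties commutativeSemigroup using (x∙yz≈y∙xz)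

  sum-lookup-removeAt : ∀ {a} {A : Set a} (f : A → Carrier) (xs : List A) k →
    sum (f ∘ lookup xs) ≈ f (lookup xs k) ∙ sum (f ∘ lookup (removeAt xs k))
  sum-lookup-removeAt f (x ∷ xs) zero    = refl
  sum-lookup-removeAt f (x ∷ xs) (suc k) =
    trans (∙-congˡ (sum-lookup-removeAt f xs k)) (x∙yz≈y∙xz _ _ _)

record IsDerivation {c ℓ} (A : NonAssociativeRing c ℓ)
                    (∂ : NonAssociativeRing.Carrier A → NonAssociativeRing.Carrier A) : Set (c ⊔ ℓ) where
  open NonAssociativeRing A hiding (zero)
  field
    cong    : ∀ {x y} → x ≈ y → ∂ x ≈ ∂ y
    +-homo  : ∀ x y → ∂ (x + y) ≈ ∂ x + ∂ y
    leibniz : ∀ x y → ∂ (x * y) ≈ ∂ x * y + x * ∂ y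

module Expansion {c ℓ} (A : NonAssociativeRing c ℓ) where
  open NonAssociativeRing A hiding (zero)
  open DetPer _+_ _*_ -_ 0# 1# using (minor; signed; det; per)
  open AbelianGroup +-abelianGroup using (monoid; commutativeMonoid; commutativeSemigroup; rawMonoid)
  open AbelianGroupProperties +-abelianGroup using (⁻¹-∙-comm)
  open GroupProperties +-group using (identityʳ-unique)
  open CommutativeSemigroupProperties commutativeSemigroup using (x∙yz≈xz∙y)
  open CommutativeMonoidSum commutativeMonoid
  open RawMonoidDefinitions rawMonoid using () renaming (_×_ to _·_)
  open SetoidReasoning setoid

  Matrix : ℕ → Set c
  Matrix n = Fin n → Fin n → Carrier

  column : ∀ {n} → Matrix n → Fin n → Vector Carrier n
  column M c i = M i c

  private module Negation = AdditiveMap +-abelianGroup +-abelianGroup -_ -‿cong (λ x y → sym (⁻¹-∙-comm x y))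

  signed-cong : ∀ k {x y} → x ≈ y → signed k x ≈ signed k y
  signed-cong zero    x≈y = x≈y
  signed-cong (suc k) x≈y = -‿cong (signed-cong k x≈y)

  signed-+ : ∀ k x y → signed k (x + y) ≈ signed k x + signed k y
  signed-+ zero    x y = refl
  signed-+ (suc k) x y = trans (-‿cong (signed-+ k x y)) (sym (⁻¹-∙-comm _ _))

  private module Signed k = AdditiveMap +-abelianGroup +-abelianGroup (signed k) (signed-cong k) (signed-+ k)

  -- Column j of the first row is weighted by (-1)^(s j): det and per are the cases s = id and s = 0.
  expansion : (ℕ → ℕ) → ∀ {n} → Matrix n → Carrier
  expansionTerm : (ℕ → ℕ) → ∀ {n} → Matrix (suc n) → Fin (suc n) → Carrier

  expansion s {zero}  M = 1#
  expansion s {suc n} M = sum (expansionTerm s M)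

  expansionTerm s M j = signed (s (toℕ j)) (M zero j * expansion s (minor M j))

  det≈expansion : ∀ {n} (M : Matrix n) → det M ≈ expansion id M
  det≈expansion {zero}  M = refl
  det≈expansion {suc n} M =
    trans (reflexive (sumFin≡foldr _+_ 0# λ j → signed (toℕ j) (M zero j * det (minor M j))))
          (sum-cong-≋ λ j → signed-cong (toℕ j) (*-congˡ {M zero j} (det≈expansion (minor M j))))

  per≈expansion : ∀ {n} (M : Matrix n) → per M ≈ expansion (λ _ → 0) M
  per≈expansion {zero}  M = refl
  per≈expansion {suc n} M =
    trans (reflexive (sumFin≡foldr _+_ 0# λ j → M zero j * per (minor M j)))
          (sum-cong-≋ λ j → *-congˡ {M zero j} (per≈expansion (minor M j)))

  replaceColumn : ∀ {n} → Matrix n → Fin n → Vector Carrier n → Matrix n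
  replaceColumn M c v i j = if does (j ≟ c) then v i else M i j

  replaceColumn-same : ∀ {n} (M : Matrix n) c v i → replaceColumn M c v i c ≡ v i
  replaceColumn-same M c v i = ≡.cong (if_then v i else M i c) (dec-true (c ≟ c) ≡.refl)

  replaceColumn-other : ∀ {n} (M : Matrix n) {c j} v i → j ≢ c → replaceColumn M c v i j ≡ M i j
  replaceColumn-other M {c} {j} v i j≢c = ≡.cong (if_then v i else M i j) (dec-false (j ≟ c) j≢c)

  replaceColumn-cong : ∀ {n} (M : Matrix n) c {u v} → (∀ i → u i ≈ v i) →
                       ∀ i j → replaceColumn M c u i j ≈ replaceColumn M c v i j
  replaceColumn-cong M c u≈v i j with does (j ≟ c)
  ... | true  = u≈v i
  ... | false = refl

  minor-replaceColumn-same : ∀ {n} (M : Matrix (suc n)) j v r k →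
                             minor (replaceColumn M j v) j r k ≡ minor M j r k
  minor-replaceColumn-same M j v r k = replaceColumn-other M v (suc r) (punchInᵢ≢i j k)

  minor-replaceColumn-other : ∀ {n} (M : Matrix (suc n)) {j c} (j≢c : j ≢ c) v r k →
    minor (replaceColumn M c v) j r k ≡ replaceColumn (minor M j) (punchOut j≢c) (v ∘ suc) r k
  minor-replaceColumn-other M {j} {c} j≢c v r k with k ≟ punchOut j≢c
  ... | yes ≡.refl = ≡.trans (≡.cong (replaceColumn M c v (suc r)) (punchIn-punchOut j≢c))
                             (replaceColumn-same M c v (suc r))
  ... | no k≢j′    = replaceColumn-other M v (suc r) λ jk≡c →
                       k≢j′ (punchIn-injective j k _ (≡.trans jk≡c (≡.sym (punchIn-punchOut j≢c))))

  module _ (s : ℕ → ℕ) where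

    expansion-cong : ∀ {n} {M N : Matrix n} → (∀ i j → M i j ≈ N i j) → expansion s M ≈ expansion s N
    expansion-cong {zero}  M≈N = refl
    expansion-cong {suc n} M≈N = sum-cong-≋ λ j → signed-cong (s (toℕ j))
      (*-cong (M≈N zero j) (expansion-cong λ r k → M≈N (suc r) (punchIn j k)))

    expansionTerm-replaceColumn-same : ∀ {n} (M : Matrix (suc n)) j v →
      expansionTerm s (replaceColumn M j v) j ≈ signed (s (toℕ j)) (v zero * expansion s (minor M j))
    expansionTerm-replaceColumn-same M j v = signed-cong (s (toℕ j))
      (*-cong (reflexive (replaceColumn-same M j v zero))
              (expansion-cong λ r k → reflexive (minor-replaceColumn-same M j v r k)))

    expansionTerm-replaceColumn-other : ∀ {n} (M : Matrix (suc n)) {j c} (j≢c : j ≢ c) v →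
      expansionTerm s (replaceColumn M c v) j
        ≈ signed (s (toℕ j)) (M zero j * expansion s (replaceColumn (minor M j) (punchOut j≢c) (v ∘ suc)))
    expansionTerm-replaceColumn-other M j≢c v = signed-cong (s (toℕ _))
      (*-cong (reflexive (replaceColumn-other M v zero j≢c))
              (expansion-cong λ r k → reflexive (minor-replaceColumn-other M j≢c v r k)))

    expansion-replaceColumn-+ : ∀ {n} (M : Matrix n) c u v →
      expansion s (replaceColumn M c (λ i → u i + v i))
        ≈ expansion s (replaceColumn M c u) + expansion s (replaceColumn M c v)
    expansion-replaceColumn-+ {suc n} M c u v = trans (sum-cong-≋ λ j → term-+ j (j ≟ c))
      (∑-distrib-+ (expansionTerm s (replaceColumn M c u)) (expansionTerm s (replaceColumn M c v)))
      where
      term-+ : ∀ j → Dec (j ≡ c) → expansionTerm s (replaceColumn M c (λ i → u i + v i)) j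
                 ≈ expansionTerm s (replaceColumn M c u) j + expansionTerm s (replaceColumn M c v) j
      term-+ j (yes ≡.refl) = begin
        expansionTerm s (replaceColumn M j (λ i → u i + v i)) j
          ≈⟨ expansionTerm-replaceColumn-same M j (λ i → u i + v i) ⟩
        σ ((u zero + v zero) * d)
          ≈⟨ trans (signed-cong (s (toℕ j)) (distribʳ d (u zero) (v zero))) (signed-+ (s (toℕ j)) _ _) ⟩
        σ (u zero * d) + σ (v zero * d)
          ≈⟨ +-cong (expansionTerm-replaceColumn-same M j u) (expansionTerm-replaceColumn-same M j v) ⟨
        expansionTerm s (replaceColumn M j u) j + expansionTerm s (replaceColumn M j v) j ∎
        where
        σ = signed (s (toℕ j))
        d = expansion s (minor M j)
      term-+ j (no j≢c) = begin
        expansionTerm s (replaceColumn M c (λ i → u i + v i)) j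
          ≈⟨ expansionTerm-replaceColumn-other M j≢c (λ i → u i + v i) ⟩
        σ (M zero j * d (λ r → u (suc r) + v (suc r)))
          ≈⟨ signed-cong (s (toℕ j)) (*-congˡ (expansion-replaceColumn-+ (minor M j) c′ (u ∘ suc) (v ∘ suc))) ⟩
        σ (M zero j * (d (u ∘ suc) + d (v ∘ suc)))
          ≈⟨ trans (signed-cong (s (toℕ j)) (distribˡ (M zero j) _ _)) (signed-+ (s (toℕ j)) _ _) ⟩
        σ (M zero j * d (u ∘ suc)) + σ (M zero j * d (v ∘ suc))
          ≈⟨ +-cong (expansionTerm-replaceColumn-other M j≢c u) (expansionTerm-replaceColumn-other M j≢c v) ⟨
        expansionTerm s (replaceColumn M c u) j + expansionTerm s (replaceColumn M c v) j ∎
        where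
        σ = signed (s (toℕ j))
        c′ = punchOut j≢c
        d : Vector Carrier n → Carrier
        d w = expansion s (replaceColumn (minor M j) c′ w)

    private
      module ColumnMap {n} (M : Matrix n) (c : Fin n) = AdditiveMap
        (Pointwise.abelianGroup (Fin n) +-abelianGroup) +-abelianGroup
        (λ v → expansion s (replaceColumn M c v))
        (λ u≈v → expansion-cong (replaceColumn-cong M c u≈v))
        (expansion-replaceColumn-+ M c)

    replaceColumn-self : ∀ {n} (M : Matrix n) c i j → replaceColumn M c (column M c) i j ≡ M i j
    replaceColumn-self M c i j with j ≟ c
    ... | yes ≡.refl = ≡.refl
    ... | no _       = ≡.refl

    differential : ∀ {n} → Matrix n → Matrix n → Carrier
    differential {n} M Δ = ∑[ c < n ] expansion s (replaceColumn M c (column Δ c))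

    differential-cong : ∀ {n} (M : Matrix n) {Δ Δ′} → (∀ i j → Δ i j ≈ Δ′ i j) →
                        differential M Δ ≈ differential M Δ′
    differential-cong M Δ≈Δ′ =
      sum-cong-≋ λ c → expansion-cong (replaceColumn-cong M c λ i → Δ≈Δ′ i c)

    differential-+ : ∀ {n} (M Δ Δ′ : Matrix n) →
                     differential M (λ i j → Δ i j + Δ′ i j) ≈ differential M Δ + differential M Δ′
    differential-+ M Δ Δ′ = trans
      (sum-cong-≋ λ c → expansion-replaceColumn-+ M c (column Δ c) (column Δ′ c))
      (∑-distrib-+ (λ c → expansion s (replaceColumn M c (column Δ c))) _)

    differential-neg : ∀ {n} (M Δ : Matrix n) → differential M (λ i j → - Δ i j) ≈ - differential M Δ
    differential-neg M Δ = trans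
      (sum-cong-≋ λ c → ColumnMap.⁻¹-homo M c (column Δ c))
      (sym (Negation.sum-homo λ c → expansion s (replaceColumn M c (column Δ c))))

    differential-sum : ∀ {m n} (M : Matrix n) (Δ : Fin m → Matrix n) →
                       differential M (λ i j → ∑[ e < m ] Δ e i j) ≈ ∑[ e < m ] differential M (Δ e)
    differential-sum {m} M Δ =
      trans (sum-cong-≋ column-sum) (∑-comm λ c e → expansion s (replaceColumn M c (column (Δ e) c)))
      where
      column-sum : ∀ c → expansion s (replaceColumn M c (λ i → ∑[ e < m ] Δ e i c))
                           ≈ ∑[ e < m ] expansion s (replaceColumn M c (column (Δ e) c))
      column-sum c = trans
        (expansion-cong (replaceColumn-cong M c λ i →
          reflexive (≡.sym (sum-pointwise monoid (λ e → column (Δ e) c) i))))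
        (ColumnMap.sum-homo M c λ e → column (Δ e) c)

    differential-self : ∀ {n} (M : Matrix n) → differential M M ≈ n · expansion s M
    differential-self {n} M = trans
      (sum-cong-≋ λ c → expansion-cong λ i j → reflexive (replaceColumn-self M c i j))
      (sum-replicate n)

    differential-column : ∀ {n} (M Δ : Matrix n) c → (∀ i j → j ≢ c → Δ i j ≈ 0#) →
                          differential M Δ ≈ expansion s (replaceColumn M c (column Δ c))
    differential-column {suc n} M Δ c Δ-off-c = begin
      ∑[ k < suc n ] t k          ≈⟨ sum-remove {i = c} t ⟩
      t c + ∑[ k < n ] t (punchIn c k)  ≈⟨ +-congˡ (trans (sum-cong-≋ other-column) (sum-replicate-zero n)) ⟩
      t c + 0#                    ≈⟨ +-identityʳ (t c) ⟩
      t c                         ∎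
      where
      t : Fin (suc n) → Carrier
      t k = expansion s (replaceColumn M k (column Δ k))

      other-column : ∀ k → t (punchIn c k) ≈ 0#
      other-column k = trans
        (expansion-cong (replaceColumn-cong M (punchIn c k) λ i → Δ-off-c i (punchIn c k) (punchInᵢ≢i c k)))
        (ColumnMap.ε-homo M (punchIn c k))

    expansion-+-column : ∀ {n} (M Δ : Matrix n) c → (∀ i j → j ≢ c → Δ i j ≈ 0#) →
                         expansion s (λ i j → M i j + Δ i j) ≈ expansion s M + differential M Δ
    expansion-+-column M Δ c Δ-off-c = begin
      expansion s (λ i j → M i j + Δ i j)
        ≈⟨ expansion-cong perturbed-column ⟩
      expansion s (replaceColumn M c (λ i → M i c + Δ i c))
        ≈⟨ expansion-replaceColumn-+ M c (column M c) (column Δ c) ⟩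
      expansion s (replaceColumn M c (column M c)) + expansion s (replaceColumn M c (column Δ c))
        ≈⟨ +-cong (expansion-cong λ i j → reflexive (replaceColumn-self M c i j))
                  (sym (differential-column M Δ c Δ-off-c)) ⟩
      expansion s M + differential M Δ ∎
      where
      perturbed-column : ∀ i j → M i j + Δ i j ≈ replaceColumn M c (λ k → M k c + Δ k c) i j
      perturbed-column i j with j ≟ c
      ... | yes ≡.refl = refl
      ... | no j≢c     = trans (+-congˡ (Δ-off-c i j j≢c)) (+-identityʳ _)

  *-distribˡ-sum : ∀ {n} x (ys : Vector Carrier n) → x * sum ys ≈ ∑[ i < n ] (x * ys i)
  *-distribˡ-sum x = LeftMultiplication.sum-homo
    where
    module LeftMultiplication = AdditiveMap +-abelianGroup +-abelianGroup (x *_) *-congˡ (distribˡ x)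

  module _ {∂ : Carrier → Carrier} (∂-isDerivation : IsDerivation A ∂) where
    open IsDerivation ∂-isDerivation renaming (cong to ∂-cong; +-homo to ∂-+; leibniz to ∂-leibniz)
    private module ∂ = AdditiveMap +-abelianGroup +-abelianGroup ∂ ∂-cong ∂-+

    ∂-1# : ∂ 1# ≈ 0#
    ∂-1# = identityʳ-unique (∂ 1#) (∂ 1#) (begin
      ∂ 1# + ∂ 1#            ≈⟨ +-cong (*-identityʳ _) (*-identityˡ _) ⟨
      ∂ 1# * 1# + 1# * ∂ 1#  ≈⟨ ∂-leibniz 1# 1# ⟨
      ∂ (1# * 1#)            ≈⟨ ∂-cong (*-identityˡ 1#) ⟩
      ∂ 1#                   ∎)

    ∂-signed : ∀ k x → ∂ (signed k x) ≈ signed k (∂ x)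
    ∂-signed zero    x = refl
    ∂-signed (suc k) x = trans (∂.⁻¹-homo _) (-‿cong (∂-signed k x))

    expansion-derivation : ∀ s {n} (M : Matrix n) → ∂ (expansion s M) ≈ differential s M (λ i j → ∂ (M i j))
    expansion-derivation s {zero}  M = ∂-1#
    expansion-derivation s {suc n} M = begin
      ∂ (sum (expansionTerm s M))                       ≈⟨ ∂.sum-homo (expansionTerm s M) ⟩
      ∑[ j < suc n ] ∂ (expansionTerm s M j)            ≈⟨ sum-cong-≋ ∂-term ⟩
      ∑[ j < suc n ] ∑[ c < suc n ] expansionTerm s (M[ c ]) j
                                                        ≈⟨ ∑-comm (λ j c → expansionTerm s (M[ c ]) j) ⟩
      differential s M (λ i j → ∂ (M i j))              ∎
      where
      ∂-column : Fin (suc n) → Vector Carrier (suc n)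
      ∂-column c i = ∂ (M i c)

      M[_] : Fin (suc n) → Matrix (suc n)
      M[ c ] = replaceColumn M c (∂-column c)

      ∂-term : ∀ j → ∂ (expansionTerm s M j) ≈ ∑[ c < suc n ] expansionTerm s (M[ c ]) j
      ∂-term j = begin
        ∂ (σ (a * d))
          ≈⟨ trans (∂-signed (s (toℕ j)) (a * d)) (signed-cong (s (toℕ j)) (∂-leibniz a d)) ⟩
        σ (∂ a * d + a * ∂ d)
          ≈⟨ signed-+ (s (toℕ j)) (∂ a * d) (a * ∂ d) ⟩
        σ (∂ a * d) + σ (a * ∂ d)
          ≈⟨ +-cong (sym (expansionTerm-replaceColumn-same s M j (∂-column j)))
                    (signed-cong (s (toℕ j)) (trans (*-congˡ {a} (expansion-derivation s (minor M j)))
                                                    (*-distribˡ-sum a (λ k → expansion s (minor-∂ k))))) ⟩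
        expansionTerm s (M[ j ]) j + σ (∑[ k < n ] (a * expansion s (minor-∂ k)))
          ≈⟨ +-congˡ (trans (Signed.sum-homo (s (toℕ j)) (λ k → a * expansion s (minor-∂ k)))
                            (sum-cong-≋ other-column)) ⟩
        expansionTerm s (M[ j ]) j + ∑[ k < n ] expansionTerm s (M[ punchIn j k ]) j
          ≈⟨ sum-remove (λ c → expansionTerm s (M[ c ]) j) ⟨
        ∑[ c < suc n ] expansionTerm s (M[ c ]) j ∎
        where
        σ : Carrier → Carrier
        σ = signed (s (toℕ j))
        a = M zero j
        d = expansion s (minor M j)

        minor-∂ : Fin n → Matrix n
        minor-∂ k = replaceColumn (minor M j) k (∂-column (punchIn j k) ∘ suc)

        other-column : ∀ k → σ (a * expansion s (minor-∂ k)) ≈ expansionTerm s (M[ punchIn j k ]) j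
        other-column k = sym (trans
          (expansionTerm-replaceColumn-other s M j≢c (∂-column (punchIn j k)))
          (reflexive (≡.cong (λ k′ → σ (a * expansion s (replaceColumn (minor M j) k′ (∂-column (punchIn j k) ∘ suc))))
                             (punchOut-punchIn j))))
          where j≢c = punchInᵢ≢i j k ∘ ≡.sym

    expansion-perturbation-sum : ∀ s {m n} (M : Matrix n) (Δ : Fin m → Matrix n) (col : Fin m → Fin n) →
      (∀ e i j → j ≢ col e → Δ e i j ≈ 0#) →
      (∀ i j → ∑[ e < m ] Δ e i j ≈ ∂ (M i j) - M i j) →
      ∑[ e < m ] expansion s (λ i j → M i j + Δ e i j)
        ≈ (m · expansion s M - n · expansion s M) + ∂ (expansion s M)
    expansion-perturbation-sum s {m} {n} M Δ col Δ-in-col ∑Δ≈∂M-M = begin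
      ∑[ e < m ] expansion s (λ i j → M i j + Δ e i j)
        ≈⟨ sum-cong-≋ (λ e → expansion-+-column s M (Δ e) (col e) (Δ-in-col e)) ⟩
      ∑[ e < m ] (g + differential s M (Δ e))
        ≈⟨ ∑-distrib-+ (λ _ → g) (λ e → differential s M (Δ e)) ⟩
      ∑[ e < m ] g + ∑[ e < m ] differential s M (Δ e)
        ≈⟨ +-cong (sum-replicate m) (sym (differential-sum s M Δ)) ⟩
      m · g + differential s M (λ i j → ∑[ e < m ] Δ e i j)
        ≈⟨ +-congˡ (differential-cong s M ∑Δ≈∂M-M) ⟩
      m · g + differential s M (λ i j → ∂ (M i j) - M i j)
        ≈⟨ +-congˡ (trans (differential-+ s M (λ i j → ∂ (M i j)) (λ i j → - M i j))
                          (+-congˡ (differential-neg s M M))) ⟩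
      m · g + (differential s M (λ i j → ∂ (M i j)) - differential s M M)
        ≈⟨ +-congˡ (+-cong (sym (expansion-derivation s M)) (-‿cong (differential-self s M))) ⟩
      m · g + (∂ g - n · g)
        ≈⟨ x∙yz≈xz∙y _ _ _ ⟩
      (m · g - n · g) + ∂ g ∎
      where g = expansion s M

module Polynomials {c ℓ} (R : CommutativeRing c ℓ) where
  open WithRing R hiding (zero)
  open RingProperties ring using (-0#≈0#; -‿distribˡ-*)
  open CommutativeSemigroupProperties *-commutativeSemigroup using (x∙yz≈y∙xz)

  -- _≋_ wrapped in a record, so that p and q can be inferred from a proof of p ≈P q.
  infix 4 _≈P_
  record _≈P_ (p q : Poly) : Set ℓ where
    constructor coeffwise
    field coeff-≈ : p ≋ q
  open _≈P_ public

  coeff-+P : ∀ p q k → coeff (p +P q) k ≈ coeff p k + coeff q k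
  coeff-+P []      q       k       = sym (+-identityˡ _)
  coeff-+P (a ∷ p) []      zero    = sym (+-identityʳ _)
  coeff-+P (a ∷ p) []      (suc k) = sym (+-identityʳ _)
  coeff-+P (a ∷ p) (b ∷ q) zero    = refl
  coeff-+P (a ∷ p) (b ∷ q) (suc k) = coeff-+P p q k

  coeff-negP : ∀ p k → coeff (-P p) k ≈ - coeff p k
  coeff-negP []      k       = sym -0#≈0#
  coeff-negP (a ∷ p) zero    = refl
  coeff-negP (a ∷ p) (suc k) = coeff-negP p k

  coeff-scaleP : ∀ a p k → coeff (scaleP a p) k ≈ a * coeff p k
  coeff-scaleP a []      k       = sym (zeroʳ a)
  coeff-scaleP a (b ∷ p) zero    = refl
  coeff-scaleP a (b ∷ p) (suc k) = coeff-scaleP a p k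

  ≈P-refl : ∀ {p} → p ≈P p
  ≈P-refl = coeffwise λ k → refl

  ≈P-sym : ∀ {p q} → p ≈P q → q ≈P p
  ≈P-sym (coeffwise e) = coeffwise λ k → sym (e k)

  ≈P-trans : ∀ {p q r} → p ≈P q → q ≈P r → p ≈P r
  ≈P-trans (coeffwise e) (coeffwise f) = coeffwise λ k → trans (e k) (f k)

  +P-cong : ∀ {p p′ q q′} → p ≈P p′ → q ≈P q′ → p +P q ≈P p′ +P q′
  +P-cong {p} {p′} {q} {q′} (coeffwise e) (coeffwise f) = coeffwise λ k →
    trans (coeff-+P p q k) (trans (+-cong (e k) (f k)) (sym (coeff-+P p′ q′ k)))

  +P-assoc : ∀ p q r → (p +P q) +P r ≈P p +P (q +P r)
  +P-assoc p q r = coeffwise λ k → begin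
    coeff ((p +P q) +P r) k              ≈⟨ trans (coeff-+P (p +P q) r k) (+-congʳ (coeff-+P p q k)) ⟩
    (coeff p k + coeff q k) + coeff r k  ≈⟨ +-assoc _ _ _ ⟩
    coeff p k + (coeff q k + coeff r k)  ≈⟨ trans (coeff-+P p (q +P r) k) (+-congˡ (coeff-+P q r k)) ⟨
    coeff (p +P (q +P r)) k              ∎
    where open SetoidReasoning setoid

  +P-comm : ∀ p q → p +P q ≈P q +P p
  +P-comm p q = coeffwise λ k → trans (coeff-+P p q k) (trans (+-comm _ _) (sym (coeff-+P q p k)))

  +P-identityʳ : ∀ p → p +P 0P ≈P p
  +P-identityʳ p = coeffwise λ k → trans (coeff-+P p [] k) (+-identityʳ _)

  -P-cong : ∀ {p q} → p ≈P q → -P p ≈P -P q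
  -P-cong {p} {q} (coeffwise e) = coeffwise λ k → trans (coeff-negP p k) (trans (-‿cong (e k)) (sym (coeff-negP q k)))

  -P-inverseˡ : ∀ p → -P p +P p ≈P 0P
  -P-inverseˡ p = coeffwise λ k → trans (coeff-+P (-P p) p k) (trans (+-congʳ (coeff-negP p k)) (-‿inverseˡ _))

  -P-inverseʳ : ∀ p → p +P -P p ≈P 0P
  -P-inverseʳ p = ≈P-trans (+P-comm p (-P p)) (-P-inverseˡ p)

  +P-abelianGroup : AbelianGroup c ℓ
  +P-abelianGroup = record
    { Carrier = Poly ; _≈_ = _≈P_ ; _∙_ = _+P_ ; ε = 0P ; _⁻¹ = -P_
    ; isAbelianGroup = record
      { isGroup = record
        { isMonoid = record
          { isSemigroup = record
            { isMagma = record
              { isEquivalence = record { refl = ≈P-refl ; sym = ≈P-sym ; trans = ≈P-trans }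
              ; ∙-cong = +P-cong }
            ; assoc = +P-assoc }
          ; identity = (λ p → ≈P-refl) , +P-identityʳ }
        ; inverse = -P-inverseˡ , -P-inverseʳ
        ; ⁻¹-cong = -P-cong }
      ; comm = +P-comm } }

  module ≈P-Reasoning = SetoidReasoning (AbelianGroup.setoid +P-abelianGroup)
  open CommutativeSemigroupProperties (AbelianGroup.commutativeSemigroup +P-abelianGroup)
    using () renaming (interchange to +P-interchange; x∙yz≈y∙xz to +P-x∙yz≈y∙xz)

  ∷-cong : ∀ {a b p q} → a ≈ b → p ≈P q → a ∷ p ≈P b ∷ q
  ∷-cong a≈b (coeffwise e) = coeffwise λ { zero → a≈b ; (suc k) → e k }

  0∷0P : 0# ∷ 0P ≈P 0P
  0∷0P = coeffwise λ { zero → refl ; (suc k) → refl }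

  scaleP-cong : ∀ {a b p q} → a ≈ b → p ≈P q → scaleP a p ≈P scaleP b q
  scaleP-cong {a} {b} {p} {q} a≈b (coeffwise e) = coeffwise λ k →
    trans (coeff-scaleP a p k) (trans (*-cong a≈b (e k)) (sym (coeff-scaleP b q k)))

  scaleP-zeroˡ : ∀ p → scaleP 0# p ≈P 0P
  scaleP-zeroˡ p = coeffwise λ k → trans (coeff-scaleP 0# p k) (zeroˡ _)

  scaleP-identityˡ : ∀ p → scaleP 1# p ≈P p
  scaleP-identityˡ p = coeffwise λ k → trans (coeff-scaleP 1# p k) (*-identityˡ _)

  scaleP-distribʳ : ∀ a b p → scaleP (a + b) p ≈P scaleP a p +P scaleP b p
  scaleP-distribʳ a b p = coeffwise λ k → trans (coeff-scaleP (a + b) p k) (trans (distribʳ _ _ _)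
    (sym (trans (coeff-+P (scaleP a p) (scaleP b p) k) (+-cong (coeff-scaleP a p k) (coeff-scaleP b p k)))))

  scaleP-distribˡ : ∀ a p q → scaleP a (p +P q) ≈P scaleP a p +P scaleP a q
  scaleP-distribˡ a p q = coeffwise λ k → trans (coeff-scaleP a (p +P q) k)
    (trans (*-congˡ (coeff-+P p q k)) (trans (distribˡ _ _ _)
    (sym (trans (coeff-+P (scaleP a p) (scaleP a q) k) (+-cong (coeff-scaleP a p k) (coeff-scaleP a q k))))))

  *P-zeroʳ : ∀ p → p *P 0P ≈P 0P
  *P-zeroʳ []      = ≈P-refl
  *P-zeroʳ (a ∷ p) = ≈P-trans (∷-cong refl (*P-zeroʳ p)) 0∷0P

  *P-zeroˡ : ∀ {p} q → p ≈P 0P → p *P q ≈P 0P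
  *P-zeroˡ {[]}    q p≈0 = ≈P-refl
  *P-zeroˡ {a ∷ p} q (coeffwise e) = ≈P-trans
    (+P-cong (≈P-trans (scaleP-cong (e zero) ≈P-refl) (scaleP-zeroˡ q))
             (∷-cong refl (*P-zeroˡ {p} q (coeffwise (λ k → e (suc k))))))
    0∷0P

  *P-congʳ : ∀ p {q q′} → q ≈P q′ → p *P q ≈P p *P q′
  *P-congʳ []      q≈q′ = ≈P-refl
  *P-congʳ (a ∷ p) q≈q′ = +P-cong (scaleP-cong refl q≈q′) (∷-cong refl (*P-congʳ p q≈q′))

  *P-congˡ : ∀ {p p′} q → p ≈P p′ → p *P q ≈P p′ *P q
  *P-congˡ {[]}    {p′}     q p≈p′ = ≈P-sym (*P-zeroˡ q (≈P-sym p≈p′))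
  *P-congˡ {a ∷ p} {[]}     q p≈p′ = *P-zeroˡ q p≈p′
  *P-congˡ {a ∷ p} {b ∷ p′} q (coeffwise e) =
    +P-cong (scaleP-cong (e zero) ≈P-refl) (∷-cong refl (*P-congˡ {p} {p′} q (coeffwise (λ k → e (suc k)))))

  *P-cong : ∀ {p p′ q q′} → p ≈P p′ → q ≈P q′ → p *P q ≈P p′ *P q′
  *P-cong {p′ = p′} {q = q} p≈p′ q≈q′ = ≈P-trans (*P-congˡ q p≈p′) (*P-congʳ p′ q≈q′)

  *P-distribʳ : ∀ r p q → (p +P q) *P r ≈P p *P r +P q *P r
  *P-distribʳ r []      q       = ≈P-refl
  *P-distribʳ r (a ∷ p) []      = ≈P-sym (+P-identityʳ _)
  *P-distribʳ r (a ∷ p) (b ∷ q) = begin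
    scaleP (a + b) r +P (0# ∷ (p +P q) *P r)
      ≈⟨ +P-cong (scaleP-distribʳ a b r) (∷-cong (sym (+-identityˡ 0#)) (*P-distribʳ r p q)) ⟩
    (scaleP a r +P scaleP b r) +P ((0# ∷ p *P r) +P (0# ∷ q *P r))
      ≈⟨ +P-interchange (scaleP a r) (scaleP b r) (0# ∷ p *P r) (0# ∷ q *P r) ⟩
    (scaleP a r +P (0# ∷ p *P r)) +P (scaleP b r +P (0# ∷ q *P r)) ∎
    where open ≈P-Reasoning

  *P-distribˡ : ∀ r p q → r *P (p +P q) ≈P r *P p +P r *P q
  *P-distribˡ []      p q = ≈P-refl
  *P-distribˡ (a ∷ r) p q = begin
    scaleP a (p +P q) +P (0# ∷ r *P (p +P q))
      ≈⟨ +P-cong (scaleP-distribˡ a p q) (∷-cong (sym (+-identityˡ 0#)) (*P-distribˡ r p q)) ⟩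
    (scaleP a p +P scaleP a q) +P ((0# ∷ r *P p) +P (0# ∷ r *P q))
      ≈⟨ +P-interchange (scaleP a p) (scaleP a q) (0# ∷ r *P p) (0# ∷ r *P q) ⟩
    (scaleP a p +P (0# ∷ r *P p)) +P (scaleP a q +P (0# ∷ r *P q)) ∎
    where open ≈P-Reasoning

  *P-identityˡ : ∀ p → 1P *P p ≈P p
  *P-identityˡ p = ≈P-trans (+P-cong (scaleP-identityˡ p) 0∷0P) (+P-identityʳ p)

  *P-identityʳ : ∀ p → p *P 1P ≈P p
  *P-identityʳ []      = ≈P-refl
  *P-identityʳ (a ∷ p) = ∷-cong (trans (+-identityʳ _) (*-identityʳ a)) (*P-identityʳ p)

  polyRing : NonAssociativeRing c ℓ
  polyRing = record
    { Carrier = Poly ; _≈_ = _≈P_ ; _+_ = _+P_ ; _*_ = _*P_ ; -_ = -P_ ; 0# = 0P ; 1# = 1P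
    ; isNonAssociativeRing = record
      { +-isAbelianGroup = AbelianGroup.isAbelianGroup +P-abelianGroup
      ; *-cong = *P-cong
      ; *-identity = *P-identityˡ , *P-identityʳ
      ; distrib = *P-distribˡ , *P-distribʳ
      ; zero = (λ p → ≈P-refl) , *P-zeroʳ } }

  open RawMonoidDefinitions (AbelianGroup.rawMonoid +P-abelianGroup) public using () renaming (_×_ to _·P_)

  constP-+ : ∀ a b → constP (a + b) ≈P constP a +P constP b
  constP-+ a b = ≈P-refl

  constP-0# : constP 0# ≈P 0P
  constP-0# = 0∷0P

  scaleP-neg : ∀ a p → scaleP (- a) p ≈P -P scaleP a p
  scaleP-neg a p = coeffwise λ k → trans (coeff-scaleP (- a) p k)
    (trans (sym (-‿distribˡ-* a (coeff p k))) (sym (trans (coeff-negP (scaleP a p) k) (-‿cong (coeff-scaleP a p k)))))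

  scaleP-ofℕ : ∀ k p → scaleP (ofℕ k) p ≈P k ·P p
  scaleP-ofℕ zero    p = scaleP-zeroˡ p
  scaleP-ofℕ (suc k) p = ≈P-trans (scaleP-distribʳ 1# (ofℕ k) p) (+P-cong (scaleP-identityˡ p) (scaleP-ofℕ k p))

  scaleP-mMinusN : ∀ m n p → scaleP (mMinusN m n) p ≈P m ·P p +P -P (n ·P p)
  scaleP-mMinusN m n p = ≈P-trans (scaleP-distribʳ (ofℕ m) (- ofℕ n) p)
    (+P-cong (scaleP-ofℕ m p) (≈P-trans (scaleP-neg (ofℕ n) p) (-P-cong (scaleP-ofℕ n p))))

  X*P-shift : ∀ p → X *P p ≈P 0# ∷ p
  X*P-shift p = +P-cong (scaleP-zeroˡ p) (∷-cong refl (*P-identityˡ p))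

  coeff-derivFrom : ∀ j p k → coeff (derivFrom j p) k ≈ ofℕ (j ℕ.+ k) * coeff p k
  coeff-derivFrom j []      k       = sym (zeroʳ _)
  coeff-derivFrom j (b ∷ p) zero    = reflexive (≡.cong (λ i → ofℕ i * b) (≡.sym (ℕ.+-identityʳ j)))
  coeff-derivFrom j (b ∷ p) (suc k) = trans (coeff-derivFrom (suc j) p k)
    (reflexive (≡.cong (λ i → ofℕ i * coeff p k) (≡.sym (ℕ.+-suc j k))))

  euler : Poly → Poly
  euler p = X *P deriv p

  coeff-euler : ∀ p k → coeff (euler p) k ≈ ofℕ k * coeff p k
  coeff-euler p       zero    = trans (coeff-≈ (X*P-shift (deriv p)) zero) (sym (zeroˡ _))
  coeff-euler []      (suc k) = trans (coeff-≈ (X*P-shift []) (suc k)) (sym (zeroʳ _))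
  coeff-euler (a ∷ p) (suc k) = trans (coeff-≈ (X*P-shift (deriv (a ∷ p))) (suc k)) (coeff-derivFrom 1 p k)

  euler-cong : ∀ {p q} → p ≈P q → euler p ≈P euler q
  euler-cong {p} {q} (coeffwise e) = coeffwise λ k →
    trans (coeff-euler p k) (trans (*-congˡ (e k)) (sym (coeff-euler q k)))

  euler-+P : ∀ p q → euler (p +P q) ≈P euler p +P euler q
  euler-+P p q = coeffwise λ k → begin
    coeff (euler (p +P q)) k                        ≈⟨ trans (coeff-euler (p +P q) k) (*-congˡ (coeff-+P p q k)) ⟩
    ofℕ k * (coeff p k + coeff q k)                 ≈⟨ distribˡ _ _ _ ⟩
    ofℕ k * coeff p k + ofℕ k * coeff q k           ≈⟨ trans (coeff-+P (euler p) (euler q) k)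
                                                             (+-cong (coeff-euler p k) (coeff-euler q k)) ⟨
    coeff (euler p +P euler q) k                    ∎
    where open SetoidReasoning setoid

  euler-scaleP : ∀ a p → euler (scaleP a p) ≈P scaleP a (euler p)
  euler-scaleP a p = coeffwise λ k → begin
    coeff (euler (scaleP a p)) k  ≈⟨ trans (coeff-euler (scaleP a p) k) (*-congˡ (coeff-scaleP a p k)) ⟩
    ofℕ k * (a * coeff p k)       ≈⟨ x∙yz≈y∙xz _ _ _ ⟩
    a * (ofℕ k * coeff p k)       ≈⟨ trans (coeff-scaleP a (euler p) k) (*-congˡ (coeff-euler p k)) ⟨
    coeff (scaleP a (euler p)) k  ∎
    where open SetoidReasoning setoid

  euler-∷ : ∀ a p → euler (a ∷ p) ≈P 0# ∷ (p +P euler p)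
  euler-∷ a p = coeffwise λ
    { zero    → trans (coeff-euler (a ∷ p) zero) (zeroˡ _)
    ; (suc k) → begin
        coeff (euler (a ∷ p)) (suc k)          ≈⟨ coeff-euler (a ∷ p) (suc k) ⟩
        (1# + ofℕ k) * coeff p k               ≈⟨ trans (distribʳ _ _ _) (+-congʳ (*-identityˡ _)) ⟩
        coeff p k + ofℕ k * coeff p k          ≈⟨ trans (coeff-+P p (euler p) k) (+-congˡ (coeff-euler p k)) ⟨
        coeff (p +P euler p) k                 ∎ }
    where open SetoidReasoning setoid

  euler-0P : euler 0P ≈P 0P
  euler-0P = *P-zeroʳ X

  euler-constP : ∀ a → euler (constP a) ≈P 0P
  euler-constP a = ≈P-trans (euler-∷ a []) (≈P-trans (∷-cong refl euler-0P) 0∷0P)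

  euler-X : euler X ≈P X
  euler-X = ≈P-trans (euler-∷ 0# 1P)
    (∷-cong refl (≈P-trans (+P-cong (≈P-refl {1P}) (euler-constP 1#)) (+P-identityʳ 1P)))

  euler-leibniz : ∀ p q → euler (p *P q) ≈P euler p *P q +P p *P euler q
  euler-leibniz []      q = ≈P-trans euler-0P (≈P-sym (≈P-trans (+P-identityʳ _) (*P-zeroˡ q euler-0P)))
  euler-leibniz (a ∷ p) q = begin
    euler (scaleP a q +P (0# ∷ p *P q))
      ≈⟨ ≈P-trans (euler-+P (scaleP a q) (0# ∷ p *P q)) (+P-cong (euler-scaleP a q) (euler-∷ 0# (p *P q))) ⟩
    scaleP a (euler q) +P (0# ∷ (p *P q +P euler (p *P q)))
      ≈⟨ +P-cong ≈P-refl (∷-cong refl (+P-cong (≈P-refl {p *P q}) (euler-leibniz p q))) ⟩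
    scaleP a (euler q) +P (0# ∷ (p *P q +P (euler p *P q +P p *P euler q)))
      ≈⟨ +P-cong ≈P-refl (∷-cong (sym (+-identityˡ 0#))
                                  (≈P-sym (+P-assoc (p *P q) (euler p *P q) (p *P euler q)))) ⟩
    scaleP a (euler q) +P ((0# ∷ (p *P q +P euler p *P q)) +P (0# ∷ p *P euler q))
      ≈⟨ +P-x∙yz≈y∙xz (scaleP a (euler q)) (0# ∷ (p *P q +P euler p *P q)) (0# ∷ p *P euler q) ⟩
    (0# ∷ (p *P q +P euler p *P q)) +P (scaleP a (euler q) +P (0# ∷ p *P euler q))
      ≈⟨ +P-cong euler-∷*P ≈P-refl ⟨
    euler (a ∷ p) *P q +P (a ∷ p) *P euler q ∎
    where
    open ≈P-Reasoning
    euler-∷*P : euler (a ∷ p) *P q ≈P 0# ∷ (p *P q +P euler p *P q)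
    euler-∷*P = ≈P-trans (*P-congˡ q (euler-∷ a p))
                         (+P-cong (scaleP-zeroˡ q) (∷-cong refl (*P-distribʳ q p (euler p))))

  euler-isDerivation : IsDerivation polyRing euler
  euler-isDerivation = record { cong = euler-cong ; +-homo = euler-+P ; leibniz = euler-leibniz }

module Digraphs {c ℓ} (R : CommutativeRing c ℓ) (β γ : CommutativeRing.Carrier R) where
  open WithRing R hiding (zero)
  open Polynomials R
  open Expansion polyRing using (Matrix; expansion; expansion-cong; expansion-perturbation-sum)
  open SemiringSum semiring using (sum-syntax; ∑-distrib-+; *-distribˡ-sum)
  open AbelianGroupProperties +-abelianGroup using (⁻¹-∙-comm)

  _≟ₐ_ : ∀ {n} (a b : Arc n) → Dec (a ≡ b)
  _≟ₐ_ = ≡-dec _≟_ _≟_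

  indicator : Bool → Carrier
  indicator b = if b then 1# else 0#

  indicator-≢ : ∀ {a} {A : Set a} (d : Dec A) → ¬ A → indicator ⌊ d ⌋ ≈ 0#
  indicator-≢ (yes a) ¬a = contradiction a ¬a
  indicator-≢ (no _)  ¬a = refl

  weight : ∀ {n} → List (Arc n) → Fin n → Fin n → Carrier
  weight es i j = indicator ⌊ i ≟ j ⌋ * (β * ofℕ (indeg es i)) + γ * indicator (adjB es i j)

  arcWeight : ∀ {n} → Arc n → Fin n → Fin n → Carrier
  arcWeight a i j = indicator ⌊ i ≟ j ⌋ * (β * indicator ⌊ proj₂ a ≟ i ⌋) + γ * indicator ⌊ (i , j) ≟ₐ a ⌋

  indeg-sum : ∀ {n} (es : List (Arc n)) v →
              ofℕ (indeg es v) ≈ ∑[ e < length es ] indicator ⌊ proj₂ (lookup es e) ≟ v ⌋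
  indeg-sum []       v = refl
  indeg-sum (a ∷ es) v with proj₂ a ≟ v
  ... | yes _ = +-congˡ (indeg-sum es v)
  ... | no  _ = trans (indeg-sum es v) (sym (+-identityˡ _))

  adjB-∷ : ∀ {n} a (es : List (Arc n)) i j → adjB (a ∷ es) i j ≡ (⌊ (i , j) ≟ₐ a ⌋ ∨ adjB es i j)
  adjB-∷ a es i j with (i , j) ≟ₐ a | any? ((i , j) ≟ₐ_) es
  ... | yes _ | _     = ≡.refl
  ... | no _  | yes _ = ≡.refl
  ... | no _  | no _  = ≡.refl

  adjB-sum : ∀ {n} {es : List (Arc n)} → Unique es → ∀ i j →
             indicator (adjB es i j) ≈ ∑[ e < length es ] indicator ⌊ (i , j) ≟ₐ lookup es e ⌋
  adjB-sum {es = []}     _           i j = refl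
  adjB-sum {es = a ∷ es} (a∉ ∷ uniq) i j =
    trans (reflexive (≡.cong indicator (adjB-∷ a es i j))) (by-cases ((i , j) ≟ₐ a))
    where
    by-cases : (d : Dec ((i , j) ≡ a)) → indicator (⌊ d ⌋ ∨ adjB es i j)
                 ≈ indicator ⌊ d ⌋ + ∑[ e < length es ] indicator ⌊ (i , j) ≟ₐ lookup es e ⌋
    by-cases (yes ≡.refl) = sym (trans (+-congˡ (trans (sym (adjB-sum uniq i j)) arc-not-repeated)) (+-identityʳ 1#))
      where
      arc-not-repeated : indicator (adjB es i j) ≈ 0#
      arc-not-repeated = indicator-≢ (any? ((i , j) ≟ₐ_) es) (All¬⇒¬Any a∉)
    by-cases (no _)       = trans (adjB-sum uniq i j) (sym (+-identityˡ _))

  weight-sum : ∀ {n} {es : List (Arc n)} → Unique es → ∀ i j →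
               weight es i j ≈ ∑[ e < length es ] arcWeight (lookup es e) i j
  weight-sum {es = es} uniq i j = begin
    δᵢⱼ * (β * ofℕ (indeg es i)) + γ * indicator (adjB es i j)
      ≈⟨ +-cong (*-congˡ (*-congˡ (indeg-sum es i))) (*-congˡ (adjB-sum uniq i j)) ⟩
    δᵢⱼ * (β * ∑[ e < m ] head e) + γ * ∑[ e < m ] arc e
      ≈⟨ +-cong (trans (*-congˡ (*-distribˡ-sum β head)) (*-distribˡ-sum δᵢⱼ (λ e → β * head e)))
                (*-distribˡ-sum γ arc) ⟩
    ∑[ e < m ] (δᵢⱼ * (β * head e)) + ∑[ e < m ] (γ * arc e)
      ≈⟨ ∑-distrib-+ (λ e → δᵢⱼ * (β * head e)) (λ e → γ * arc e) ⟨
    ∑[ e < m ] arcWeight (lookup es e) i j ∎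
    where
    open SetoidReasoning setoid
    m = length es
    δᵢⱼ = indicator ⌊ i ≟ j ⌋
    head arc : Fin m → Carrier
    head e = indicator ⌊ proj₂ (lookup es e) ≟ i ⌋
    arc e = indicator ⌊ (i , j) ≟ₐ lookup es e ⌋

  weight-removeAt : ∀ {n} {es : List (Arc n)} → Unique es → ∀ k i j →
                    weight es i j ≈ weight (removeAt es k) i j + arcWeight (lookup es k) i j
  weight-removeAt {es = es} uniq k i j = begin
    weight es i j
      ≈⟨ weight-sum uniq i j ⟩
    ∑[ e < length es ] arcWeight (lookup es e) i j
      ≈⟨ sum-lookup-removeAt +-commutativeMonoid (λ a → arcWeight a i j) es k ⟩
    arcWeight (lookup es k) i j + ∑[ e < length (removeAt es k) ] arcWeight (lookup (removeAt es k) e) i j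
      ≈⟨ trans (+-congʳ (weight-sum (Unique-removeAt uniq k) i j)) (+-comm _ _) ⟨
    weight (removeAt es k) i j + arcWeight (lookup es k) i j ∎
    where open SetoidReasoning setoid

  arcWeight-column : ∀ {n} (a : Arc n) i j → j ≢ proj₂ a → arcWeight a i j ≈ 0#
  arcWeight-column a i j j≢h = trans
    (+-cong (loop-term (i ≟ j))
            (trans (*-congˡ (indicator-≢ ((i , j) ≟ₐ a) (j≢h ∘ ≡.cong proj₂))) (zeroʳ γ)))
    (+-identityˡ 0#)
    where
    loop-term : (d : Dec (i ≡ j)) → indicator ⌊ d ⌋ * (β * indicator ⌊ proj₂ a ≟ i ⌋) ≈ 0#
    loop-term (yes ≡.refl) = trans (*-congˡ (trans (*-congˡ (indicator-≢ (proj₂ a ≟ i) (j≢h ∘ ≡.sym))) (zeroʳ β)))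
                                   (zeroʳ _)
    loop-term (no _)       = zeroˡ _

  xI : ∀ {n} → Fin n → Fin n → Poly
  xI i j = if ⌊ i ≟ j ⌋ then X else 0P

  euler-xI : ∀ {n} (i j : Fin n) → euler (xI i j) ≈P xI i j
  euler-xI i j with i ≟ j
  ... | yes _ = euler-X
  ... | no  _ = euler-0P

  charMat-+-weight : ∀ {n} (es : List (Arc n)) i j → charMat β γ es i j +P constP (weight es i j) ≈P xI i j
  charMat-+-weight es i j with i ≟ j
  ... | yes _ = ∷-cong (begin
      ((0# + - x) + - y) + (1# * x + y)  ≈⟨ +-cong (+-congʳ (+-identityˡ (- x))) (+-congʳ (*-identityˡ x)) ⟩
      (- x + - y) + (x + y)              ≈⟨ +-congʳ (⁻¹-∙-comm x y) ⟩
      - (x + y) + (x + y)                ≈⟨ -‿inverseˡ (x + y) ⟩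
      0#                                 ∎) ≈P-refl
    where
    open SetoidReasoning setoid
    x = β * ofℕ (indeg es i)
    y = γ * indicator (adjB es i j)
  ... | no  _ = ≈P-trans (∷-cong (begin
      - y + (0# * x + y)  ≈⟨ +-congˡ (trans (+-congʳ (zeroˡ x)) (+-identityˡ y)) ⟩
      - y + y             ≈⟨ -‿inverseˡ y ⟩
      0#                  ∎) ≈P-refl) 0∷0P
    where
    open SetoidReasoning setoid
    x = β * ofℕ (indeg es i)
    y = γ * indicator (adjB es i j)

  private
    module P = AbelianGroup +P-abelianGroup
    module ΣP = CommutativeMonoidSum P.commutativeMonoid
    module ConstP = AdditiveMap +-abelianGroup +P-abelianGroup constP (λ a≈b → ∷-cong a≈b ≈P-refl) constP-+
  open GroupProperties P.group using (∙-cancelʳ)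
  open AbelianGroupProperties +P-abelianGroup using (xyx⁻¹≈y)

  charMat-removeAt : ∀ {n} {es : List (Arc n)} → Unique es → ∀ k i j →
    charMat β γ (removeAt es k) i j ≈P charMat β γ es i j +P constP (arcWeight (lookup es k) i j)
  charMat-removeAt {es = es} uniq k i j = ∙-cancelʳ (constP w′) _ _ (begin
    charMat β γ (removeAt es k) i j +P constP w′
      ≈⟨ charMat-+-weight (removeAt es k) i j ⟩
    xI i j
      ≈⟨ charMat-+-weight es i j ⟨
    M +P constP (weight es i j)
      ≈⟨ +P-cong ≈P-refl (∷-cong (trans (weight-removeAt uniq k i j) (+-comm _ _)) ≈P-refl) ⟩
    M +P (constP w +P constP w′)
      ≈⟨ +P-assoc M (constP w) (constP w′) ⟨
    M +P constP w +P constP w′ ∎)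
    where
    open ≈P-Reasoning
    M = charMat β γ es i j
    w = arcWeight (lookup es k) i j
    w′ = weight (removeAt es k) i j

  euler-charMat : ∀ {n} (es : List (Arc n)) i j → euler (charMat β γ es i j) ≈P xI i j
  euler-charMat es i j = begin
    euler M                                     ≈⟨ +P-identityʳ (euler M) ⟨
    euler M +P 0P                               ≈⟨ +P-cong ≈P-refl (euler-constP (weight es i j)) ⟨
    euler M +P euler (constP (weight es i j))   ≈⟨ euler-+P M _ ⟨
    euler (M +P constP (weight es i j))         ≈⟨ euler-cong (charMat-+-weight es i j) ⟩
    euler (xI i j)                              ≈⟨ euler-xI i j ⟩
    xI i j                                      ∎
    where
    open ≈P-Reasoning
    M = charMat β γ es i j

  arcWeights-sum : ∀ {n} {es : List (Arc n)} → Unique es → ∀ i j →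
    ΣP.sum (λ e → constP (arcWeight (lookup es e) i j)) ≈P euler (charMat β γ es i j) +P -P charMat β γ es i j
  arcWeights-sum {es = es} uniq i j = begin
    ΣP.sum (λ e → constP (w e))
      ≈⟨ ConstP.sum-homo w ⟨
    constP (∑[ e < length es ] w e)
      ≈⟨ ∷-cong (weight-sum uniq i j) ≈P-refl ⟨
    constP (weight es i j)
      ≈⟨ xyx⁻¹≈y M (constP (weight es i j)) ⟨
    M +P constP (weight es i j) +P -P M
      ≈⟨ +P-cong (charMat-+-weight es i j) ≈P-refl ⟩
    xI i j +P -P M
      ≈⟨ +P-cong (euler-charMat es i j) ≈P-refl ⟨
    euler M +P -P M ∎
    where
    open ≈P-Reasoning
    M = charMat β γ es i j
    w : Fin (length es) → Carrier
    w e = arcWeight (lookup es e) i j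

  deletion-formula : ∀ {n} (f : Matrix n → Poly) s → (∀ M → f M ≈P expansion s M) →
    ∀ (es : List (Arc n)) → Unique es →
    scaleP (mMinusN (length es) n) (f (charMat β γ es)) +P X *P deriv (f (charMat β γ es))
      ≋ sumDeleted (λ fs → f (charMat β γ fs)) es
  deletion-formula {n} f s f≈expansion es uniq = coeff-≈ (begin
    scaleP (mMinusN m n) (f M) +P euler (f M)
      ≈⟨ +P-cong (scaleP-cong refl (f≈expansion M)) (euler-cong (f≈expansion M)) ⟩
    scaleP (mMinusN m n) g +P euler g
      ≈⟨ +P-cong (scaleP-mMinusN m n g) ≈P-refl ⟩
    (m ·P g +P -P (n ·P g)) +P euler g
      ≈⟨ expansion-perturbation-sum euler-isDerivation s M Δ (λ e → proj₂ (lookup es e))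
           (λ e i j j≢h → ≈P-trans (∷-cong (arcWeight-column (lookup es e) i j j≢h) ≈P-refl) constP-0#)
           (arcWeights-sum uniq) ⟨
    ΣP.sum (λ e → expansion s (λ i j → M i j +P Δ e i j))
      ≈⟨ ΣP.sum-cong-≋ (λ e → expansion-cong s (λ i j → charMat-removeAt uniq e i j)) ⟨
    ΣP.sum (λ e → expansion s (charMat β γ (removeAt es e)))
      ≈⟨ ΣP.sum-cong-≋ (λ e → f≈expansion (charMat β γ (removeAt es e))) ⟨
    ΣP.sum (λ e → f (charMat β γ (removeAt es e)))
      ≡⟨ sumFin≡foldr _+P_ 0P (λ e → f (charMat β γ (removeAt es e))) ⟨
    sumDeleted (λ fs → f (charMat β γ fs)) es ∎)
    where
    open ≈P-Reasoning
    m = length es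
    M = charMat β γ es
    g = expansion s M
    Δ : Fin m → Matrix n
    Δ e i j = constP (arcWeight (lookup es e) i j)

theorem3p1 : ∀ {c ℓ} (R : CommutativeRing c ℓ) → let open WithRing R in
    (β γ : Carrier) → ¬ (γ ≈ 0#) → (n : ℕ) → (G : Digraph n) →
      (scaleP (mMinusN (length (Digraph.arcs G)) n) (g₁ β γ (Digraph.arcs G))
          +P X *P deriv (g₁ β γ (Digraph.arcs G))
        ≋ sumDeleted (g₁ β γ) (Digraph.arcs G))
      ×
      (scaleP (mMinusN (length (Digraph.arcs G)) n) (g₂ β γ (Digraph.arcs G))
          +P X *P deriv (g₂ β γ (Digraph.arcs G))
        ≋ sumDeleted (g₂ β γ) (Digraph.arcs G))
theorem3p1 R β γ _ n G =
  deletion-formula det id det≈expansion (Digraph.arcs G) (Digraph.simple G) ,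
  deletion-formula per (λ _ → 0) per≈expansion (Digraph.arcs G) (Digraph.simple G)
  where
  open WithRing R using (det; per)
  open Digraphs R β γ using (deletion-formula)
  open Expansion (Polynomials.polyRing R) using (det≈expansion; per≈expansion)
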